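{- There exist a profinite subgroup $G$ of $S_\infty$ (without orbit independence) and an existential sentence $\alpha$ in the language of groups such that $G_k\models\alpha$ for all $k\in\mathbb{N}$, but $G\models\neg\alpha$.
   Context: $S_\infty$ is the group of all permutations of $\mathbb{N}$, with the topology of pointwise convergence; its profinite subgroups are exactly the closed subgroups all of whose orbits $\mathrm{orb}_G(n)=\{g(n):g\in G\}$ are finite. The orbits of a profinite $G$ are enumerated as $O_{G,0}=\mathrm{orb}_G(0)$ and $O_{G,n+1}=$ the orbit of the least natural number not in any $O_{G,m}$, $m\le n$. For $g\in G$ and $k\in\mathbb{N}$, $g_k=g\restriction\bigcup_{i\le k}O_{G,i}$, and $G_k=\{g_k:g\in G\}$, a finite group under composition. $H_k=\{g\restriction O_{G,k}:g\in G\}$; $G$ has orbit independence if $G$ is isomorphic to $\prod_{k\in\mathbb{N}}H_k$. -}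

module Defs where

open import Level using (0ℓ)
open import Data.Nat using (ℕ; zero; suc; _<_; _≤_)
open import Data.Fin using (Fin)
open import Data.Product using (Σ; Σ-syntax; ∃; ∃-syntax; _×_; _,_; proj₁; proj₂)
open import Data.Sum using (_⊎_)
open import Relation.Nullary using (¬_)
open import Relation.Binary.PropositionalEquality using (_≡_)
open import Algebra.Bundles.Raw using (RawGroup)

record Perm : Set where
  field
    fun    : ℕ → ℕ
    inv    : ℕ → ℕ
    inv-l  : ∀ n → inv (fun n) ≡ n
    inv-r  : ∀ n → fun (inv n) ≡ n
open Perm public

_≈ₚ_ : Perm → Perm → Set
p ≈ₚ q = ∀ n → fun p n ≡ fun q n

idₚ : Perm
idₚ = record { fun = λ n → n ; inv = λ n → n
             ; inv-l = λ n → Relation.Binary.PropositionalEquality.refl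
             ; inv-r = λ n → Relation.Binary.PropositionalEquality.refl }

_∘ₚ_ : Perm → Perm → Perm
p ∘ₚ q = record
  { fun = λ n → fun p (fun q n)
  ; inv = λ n → inv q (inv p n)
  ; inv-l = λ n → trans (cong (inv q) (inv-l p (fun q n))) (inv-l q n)
  ; inv-r = λ n → trans (cong (fun p) (inv-r q (inv p n))) (inv-r p n)
  }
  where open Relation.Binary.PropositionalEquality using (trans; cong)

_⁻¹ₚ : Perm → Perm
p ⁻¹ₚ = record { fun = inv p ; inv = fun p ; inv-l = inv-r p ; inv-r = inv-l p }

record IsSubgroup (G : Perm → Set) : Set where
  field
    respects : ∀ {p q} → p ≈ₚ q → G p → G q
    has-id   : G idₚ
    has-∘    : ∀ {p q} → G p → G q → G (p ∘ₚ q)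
    has-⁻¹   : ∀ {p} → G p → G (p ⁻¹ₚ)

-- closed in the topology of pointwise convergence: every permutation
-- which is approximated on each initial segment {0,…,n-1} by elements
-- of G belongs to G
IsClosed : (Perm → Set) → Set
IsClosed G = ∀ p → (∀ n → Σ[ g ∈ Perm ] (G g × (∀ i → i < n → fun g i ≡ fun p i))) → G p

InOrb : (Perm → Set) → ℕ → ℕ → Set
InOrb G n m = Σ[ g ∈ Perm ] (G g × fun g n ≡ m)

-- an orbit (a subset of ℕ) is finite iff it is bounded
HasFiniteOrbits : (Perm → Set) → Set
HasFiniteOrbits G = ∀ n → Σ[ N ∈ ℕ ] (∀ m → InOrb G n m → m < N)

record IsProfinite (G : Perm → Set) : Set where
  field
    isSubgroup  : IsSubgroup G
    isClosed    : IsClosed G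
    finiteOrbits : HasFiniteOrbits G
open IsProfinite public

-- Enumeration of orbits.
-- Rep G k r  :  r is the least element of O_{G,k}
--               (so O_{G,k} = orb_G(r)).
-- Pre G k n  :  n ∈ O_{G,0} ∪ … ∪ O_{G,k}.

mutual
  Rep : (Perm → Set) → ℕ → ℕ → Set
  Rep G zero    r = r ≡ 0
  Rep G (suc k) r = ¬ Pre G k r × (∀ m → m < r → Pre G k m)

  Pre : (Perm → Set) → ℕ → ℕ → Set
  Pre G zero    n = Σ[ r ∈ ℕ ] (Rep G zero r × InOrb G r n)
  Pre G (suc k) n = Pre G k n ⊎ Σ[ r ∈ ℕ ] (Rep G (suc k) r × InOrb G r n)

groupG : (G : Perm → Set) → IsSubgroup G → RawGroup 0ℓ 0ℓ
groupG G sg = record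
  { Carrier = Σ Perm G
  ; _≈_ = λ g h → proj₁ g ≈ₚ proj₁ h
  ; _∙_ = λ g h → (proj₁ g ∘ₚ proj₁ h) , IsSubgroup.has-∘ sg (proj₂ g) (proj₂ h)
  ; ε = idₚ , IsSubgroup.has-id sg
  ; _⁻¹ = λ g → (proj₁ g ⁻¹ₚ) , IsSubgroup.has-⁻¹ sg (proj₂ g)
  }

-- G_k = { g ↾ (O_{G,0} ∪ … ∪ O_{G,k}) : g ∈ G } under composition,
-- presented as the setoid quotient of G identifying g and h when
-- g_k = h_k, i.e. when they agree on O_{G,0} ∪ … ∪ O_{G,k}.
groupGk : (G : Perm → Set) → IsSubgroup G → ℕ → RawGroup 0ℓ 0ℓ
groupGk G sg k = record
  { Carrier = Σ Perm G
  ; _≈_ = λ g h → ∀ n → Pre G k n → fun (proj₁ g) n ≡ fun (proj₁ h) n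
  ; _∙_ = RawGroup._∙_ (groupG G sg)
  ; ε = RawGroup.ε (groupG G sg)
  ; _⁻¹ = RawGroup._⁻¹ (groupG G sg)
  }

data Term (n : ℕ) : Set where
  var  : Fin n → Term n
  e    : Term n
  _·_  : Term n → Term n → Term n
  _⁻¹ₜ : Term n → Term n

data QF (n : ℕ) : Set where
  _≐_  : Term n → Term n → QF n
  ¬ᶠ_  : QF n → QF n
  _∧ᶠ_ : QF n → QF n → QF n
  _∨ᶠ_ : QF n → QF n → QF n

record ExSentence : Set where
  constructor ∃ˢ
  field
    arity : ℕ
    body  : QF arity
open ExSentence public

module _ (M : RawGroup 0ℓ 0ℓ) where
  open RawGroup M

  eval : ∀ {n} → (Fin n → Carrier) → Term n → Carrier
  eval ρ (var i)  = ρ i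
  eval ρ e        = ε
  eval ρ (t · s)  = eval ρ t ∙ eval ρ s
  eval ρ (t ⁻¹ₜ)  = eval ρ t ⁻¹

  SatQF : ∀ {n} → (Fin n → Carrier) → QF n → Set
  SatQF ρ (t ≐ s)  = eval ρ t ≈ eval ρ s
  SatQF ρ (¬ᶠ φ)   = ¬ SatQF ρ φ
  SatQF ρ (φ ∧ᶠ ψ) = SatQF ρ φ × SatQF ρ ψ
  SatQF ρ (φ ∨ᶠ ψ) = SatQF ρ φ ⊎ SatQF ρ ψ

  _⊨_ : ExSentence → Set
  _⊨_ α = Σ[ ρ ∈ (Fin (arity α) → Carrier) ] SatQF ρ (body α)

{-# OPTIONS --safe #-}
-- Identify ℕ with the nonempty words in bijective base 2 (digits 1 and 2), n ↦ the
-- numeral of n + 1.  The odometer adds one to a word of length L modulo 2^L, so it cycles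
-- through the 2^L words of each length, and the closure G of its powers is the 2-adic
-- integers ℤ₂ acting level by level.  The L-th level is exactly the orbit O_{G,L-1}, so
-- G_k is cyclic of order 2^(k+1) and odometer^(2^k) is an involution in it.  But ℤ₂ is
-- torsion-free: if x² = 1 and x agrees with odometer^t on the words of length ≤ L + 1,
-- then odometer^(2t) fixes the word 1w for every w of length L, and since odometer^(2t)
-- acts on 1w as odometer^t acts on w, x fixes every word of length L.
module Submission where

open import Defs
open import Data.Nat using (ℕ)
open import Data.Product using (Σ; Σ-syntax; _×_)
open import Relation.Nullary using (¬_)

open import Data.Nat
  using (zero; suc; _+_; _*_; _^_; _≤_; _<_; z≤n; s≤s; s≤s⁻¹; _≤?_; pred)
open import Data.Nat.Properties
  using (≤-refl; ≤-reflexive; ≤-antisym; m≤n⇒m≤1+n; n≤1+n; <-irrefl; <⇒≱; ≮⇒≥;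
         ≰⇒>; *-monoʳ-≤; *-monoʳ-<; *-distribʳ-+; *-identityʳ; +-identityʳ; +-suc;
         suc-injective; suc-pred; m^n≢0)
open import Data.Nat.Binary.Base using (ℕᵇ; 2[1+_]; 1+[2_]; size; toℕ; fromℕ)
  renaming (zero to 0ᵇ)
open import Data.Nat.Binary.Properties
  using (toℕ-fromℕ; fromℕ-toℕ; fromℕ-injective; 1+[2_]-injective; 2[1+_]-injective)
open import Data.Product using (∃-syntax; _,_; proj₁; proj₂)
open import Data.Sum using (inj₁; inj₂)
open import Data.Fin using () renaming (zero to x₀)
open import Function using (_∘_; _⇔_; mk⇔; Equivalence)
open import Function.Construct.Symmetry using (⇔-sym)
open import Function.Construct.Composition using (_⇔-∘_)
open import Function.Endo.Propositional ℕᵇ using () renaming (_^_ to _^ᶠ_)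
open import Relation.Nullary using (yes; no)
open import Relation.Binary.PropositionalEquality
open ≡-Reasoning
open Equivalence using (to; from)

2^[1+n]≡2^n+2^n : ∀ n → 2 ^ suc n ≡ 2 ^ n + 2 ^ n
2^[1+n]≡2^n+2^n n = cong (2 ^ n +_) (+-identityʳ (2 ^ n))

2^[1+n]*c≡2^n*c+2^n*c : ∀ n c → 2 ^ suc n * c ≡ 2 ^ n * c + 2 ^ n * c
2^[1+n]*c≡2^n*c+2^n*c n c =
  trans (cong (_* c) (2^[1+n]≡2^n+2^n n)) (*-distribʳ-+ c (2 ^ n) (2 ^ n))

-- Adding one in bijective base 2 (least significant digit first), dropping the final
-- carry so that the length is preserved.
rotate : ℕᵇ → ℕᵇ
rotate 0ᵇ       = 0ᵇ
rotate 1+[2 x ] = 2[1+ x ]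
rotate 2[1+ x ] = 1+[2 rotate x ]

unrotate : ℕᵇ → ℕᵇ
unrotate 0ᵇ       = 0ᵇ
unrotate 2[1+ x ] = 1+[2 x ]
unrotate 1+[2 x ] = 2[1+ unrotate x ]

unrotate-rotate : ∀ w → unrotate (rotate w) ≡ w
unrotate-rotate 0ᵇ       = refl
unrotate-rotate 1+[2 x ] = refl
unrotate-rotate 2[1+ x ] = cong 2[1+_] (unrotate-rotate x)

rotate-unrotate : ∀ w → rotate (unrotate w) ≡ w
rotate-unrotate 0ᵇ       = refl
rotate-unrotate 2[1+ x ] = refl
rotate-unrotate 1+[2 x ] = cong 1+[2_] (rotate-unrotate x)

SizePreserving : (ℕᵇ → ℕᵇ) → Set
SizePreserving f = ∀ w → size (f w) ≡ size w

size-rotate : SizePreserving rotate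
size-rotate 0ᵇ       = refl
size-rotate 1+[2 x ] = refl
size-rotate 2[1+ x ] = cong suc (size-rotate x)

size-unrotate : SizePreserving unrotate
size-unrotate 0ᵇ       = refl
size-unrotate 2[1+ x ] = refl
size-unrotate 1+[2 x ] = cong suc (size-unrotate x)

rotate^-0ᵇ : ∀ t → (rotate ^ᶠ t) 0ᵇ ≡ 0ᵇ
rotate^-0ᵇ zero    = refl
rotate^-0ᵇ (suc t) = cong rotate (rotate^-0ᵇ t)

rotate^-double-1+[2_] : ∀ u y → (rotate ^ᶠ (u + u)) 1+[2 y ] ≡ 1+[2 (rotate ^ᶠ u) y ]
rotate^-double-1+[2_] zero    y = refl
rotate^-double-1+[2_] (suc u) y rewrite +-suc u u =
  cong (rotate ∘ rotate) (rotate^-double-1+[2_] u y)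

rotate^-double-2[1+_] : ∀ u y → (rotate ^ᶠ (u + u)) 2[1+ y ] ≡ 2[1+ (rotate ^ᶠ u) y ]
rotate^-double-2[1+_] zero    y = refl
rotate^-double-2[1+_] (suc u) y rewrite +-suc u u =
  cong (rotate ∘ rotate) (rotate^-double-2[1+_] u y)

rotate^-period : ∀ N c {w} → size w ≤ N → (rotate ^ᶠ (2 ^ N * c)) w ≡ w
rotate^-period N       c {0ᵇ}       _        = rotate^-0ᵇ (2 ^ N * c)
rotate^-period (suc N) c {1+[2 x ]} (s≤s le) rewrite 2^[1+n]*c≡2^n*c+2^n*c N c =
  trans (rotate^-double-1+[2_] (2 ^ N * c) x) (cong 1+[2_] (rotate^-period N c le))
rotate^-period (suc N) c {2[1+ x ]} (s≤s le) rewrite 2^[1+n]*c≡2^n*c+2^n*c N c =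
  trans (rotate^-double-2[1+_] (2 ^ N * c) x) (cong 2[1+_] (rotate^-period N c le))

rotate^-moves : ∀ k {w} → size w ≡ suc k → (rotate ^ᶠ (2 ^ k)) w ≢ w
rotate^-moves zero    {1+[2 x ]} _ ()
rotate^-moves zero    {2[1+ x ]} _ ()
rotate^-moves (suc k) {1+[2 x ]} eq fixed rewrite 2^[1+n]≡2^n+2^n k =
  rotate^-moves k (suc-injective eq)
    (1+[2_]-injective (trans (sym (rotate^-double-1+[2_] (2 ^ k) x)) fixed))
rotate^-moves (suc k) {2[1+ x ]} eq fixed rewrite 2^[1+n]≡2^n+2^n k =
  rotate^-moves k (suc-injective eq)
    (2[1+_]-injective (trans (sym (rotate^-double-2[1+_] (2 ^ k) x)) fixed))

ones : ℕ → ℕᵇ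
ones zero    = 0ᵇ
ones (suc L) = 1+[2 ones L ]

size-ones : ∀ L → size (ones L) ≡ L
size-ones zero    = refl
size-ones (suc L) = cong suc (size-ones L)

rotate^-from-ones : ∀ w → ∃[ j ] (rotate ^ᶠ j) (ones (size w)) ≡ w
rotate^-from-ones 0ᵇ       = 0 , refl
rotate^-from-ones 1+[2 x ] = let (j , reach) = rotate^-from-ones x in
  j + j , trans (rotate^-double-1+[2_] j _) (cong 1+[2_] reach)
rotate^-from-ones 2[1+ x ] = let (j , reach) = rotate^-from-ones x in
  suc (j + j) , cong rotate (trans (rotate^-double-1+[2_] j _) (cong 1+[2_] reach))

size≤⇒<ones : ∀ {L} w → size w ≤ L → toℕ w < toℕ (ones (suc L))
size≤⇒<ones 0ᵇ       _        = s≤s z≤n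
size≤⇒<ones 1+[2 x ] (s≤s le) = s≤s (*-monoʳ-< 2 (size≤⇒<ones x le))
size≤⇒<ones 2[1+ x ] (s≤s le) = s≤s (*-monoʳ-≤ 2 (size≤⇒<ones x le))

≤size⇒ones≤ : ∀ {L} w → L ≤ size w → toℕ (ones L) ≤ toℕ w
≤size⇒ones≤ {zero}  _        _        = z≤n
≤size⇒ones≤ {suc _} 1+[2 x ] (s≤s le) = s≤s (*-monoʳ-≤ 2 (≤size⇒ones≤ x le))
≤size⇒ones≤ {suc _} 2[1+ x ] (s≤s le) = *-monoʳ-< 2 (s≤s (≤size⇒ones≤ x le))

<ones⇔size≤ : ∀ {L} w → toℕ w < toℕ (ones (suc L)) ⇔ size w ≤ L
<ones⇔size≤ w = mk⇔ (λ w<ones → ≮⇒≥ (<⇒≱ w<ones ∘ ≤size⇒ones≤ w))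
                    (size≤⇒<ones w)

word : ℕ → ℕᵇ
word n = fromℕ (suc n)

index : ℕᵇ → ℕ
index w = pred (toℕ w)

level : ℕ → ℕ
level n = size (word n)

toℕ-word : ∀ n → toℕ (word n) ≡ suc n
toℕ-word n = toℕ-fromℕ (suc n)

index-word : ∀ n → index (word n) ≡ n
index-word n = cong pred (toℕ-word n)

word-injective : ∀ m n → word m ≡ word n → m ≡ n
word-injective m n = suc-injective ∘ fromℕ-injective

word-index : ∀ {w} → 0 < size w → word (index w) ≡ w
word-index {1+[2 x ]} _ = fromℕ-toℕ 1+[2 x ]
word-index {2[1+ x ]} _ = fromℕ-toℕ 2[1+ x ]

0<level : ∀ n → 0 < level n
0<level n = nonzero (word n) (toℕ-word n)
  where
  nonzero : ∀ w → toℕ w ≡ suc n → 0 < size w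
  nonzero 1+[2 _ ] _ = s≤s z≤n
  nonzero 2[1+ _ ] _ = s≤s z≤n

-- The least number of level L, for L ≥ 1.
least : ℕ → ℕ
least L = index (ones L)

level-least : ∀ L → level (least (suc L)) ≡ suc L
level-least L = trans (cong size (word-index {ones (suc L)} (s≤s z≤n))) (size-ones (suc L))

<least⇔level≤ : ∀ {L m} → m < least (suc L) ⇔ level m ≤ L
<least⇔level≤ {L} {m} = <ones⇔size≤ (word m) ⇔-∘ shift
  where
  -- suc (least (suc L)) computes to toℕ (ones (suc L)).
  shift : m < least (suc L) ⇔ toℕ (word m) < toℕ (ones (suc L))
  shift rewrite toℕ-word m = mk⇔ s≤s s≤s⁻¹

onWords : (ℕᵇ → ℕᵇ) → ℕ → ℕ
onWords f n = index (f (word n))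

word-onWords : ∀ {f} → SizePreserving f → ∀ n → word (onWords f n) ≡ f (word n)
word-onWords size-f n = word-index (subst (0 <_) (sym (size-f (word n))) (0<level n))

level-onWords : ∀ {f} → SizePreserving f → ∀ n → level (onWords f n) ≡ level n
level-onWords size-f n = trans (cong size (word-onWords size-f n)) (size-f (word n))

onWords-inverse : ∀ f g → SizePreserving f → (∀ w → g (f w) ≡ w) →
                  ∀ n → onWords g (onWords f n) ≡ n
onWords-inverse f g size-f g∘f n = begin
  index (g (word (onWords f n))) ≡⟨ cong (index ∘ g) (word-onWords size-f n) ⟩
  index (g (f (word n)))         ≡⟨ cong index (g∘f (word n)) ⟩
  index (word n)                 ≡⟨ index-word n ⟩
  n                              ∎

odometer : Perm
odometer = record
  { fun   = onWords rotate
  ; inv   = onWords unrotate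
  ; inv-l = onWords-inverse rotate unrotate size-rotate unrotate-rotate
  ; inv-r = onWords-inverse unrotate rotate size-unrotate rotate-unrotate
  }

_^ₚ_ : Perm → ℕ → Perm
p ^ₚ zero  = idₚ
p ^ₚ suc t = p ∘ₚ (p ^ₚ t)

^ₚ-+ : ∀ p a b → (p ^ₚ (a + b)) ≈ₚ ((p ^ₚ a) ∘ₚ (p ^ₚ b))
^ₚ-+ p zero    b n = refl
^ₚ-+ p (suc a) b n = cong (fun p) (^ₚ-+ p a b n)

word-odometer^ : ∀ t n → word (fun (odometer ^ₚ t) n) ≡ (rotate ^ᶠ t) (word n)
word-odometer^ zero    n = refl
word-odometer^ (suc t) n =
  trans (word-onWords size-rotate (fun (odometer ^ₚ t) n)) (cong rotate (word-odometer^ t n))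

level-odometer^ : ∀ t n → level (fun (odometer ^ₚ t) n) ≡ level n
level-odometer^ zero    n = refl
level-odometer^ (suc t) n =
  trans (level-onWords size-rotate (fun (odometer ^ₚ t) n)) (level-odometer^ t n)

odometer^-level≤ : ∀ s {n N} → level n ≤ N → level (fun (odometer ^ₚ s) n) ≤ N
odometer^-level≤ s {n} {N} = subst (_≤ N) (sym (level-odometer^ s n))

odometer^-fixes⇔ : ∀ t n → fun (odometer ^ₚ t) n ≡ n ⇔ (rotate ^ᶠ t) (word n) ≡ word n
odometer^-fixes⇔ t n = mk⇔
  (λ fixed → trans (sym (word-odometer^ t n)) (cong word fixed))
  (λ fixed → word-injective _ n (trans (word-odometer^ t n) fixed))

odometer^-period : ∀ N c {n} → level n ≤ N → fun (odometer ^ₚ (2 ^ N * c)) n ≡ n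
odometer^-period N c {n} le = from (odometer^-fixes⇔ (2 ^ N * c) n) (rotate^-period N c le)

odometer^-moves-least : ∀ k → fun (odometer ^ₚ (2 ^ k)) (least (suc k)) ≢ least (suc k)
odometer^-moves-least k =
  rotate^-moves k (level-least k) ∘ to (odometer^-fixes⇔ (2 ^ k) (least (suc k)))

odometer^[2^k]-involutive : ∀ k {n} → level n ≤ suc k →
                            fun (odometer ^ₚ (2 ^ k)) (fun (odometer ^ₚ (2 ^ k)) n) ≡ n
odometer^[2^k]-involutive k {n} le = begin
  fun (odometer ^ₚ (2 ^ k)) (fun (odometer ^ₚ (2 ^ k)) n)
    ≡⟨ sym (^ₚ-+ odometer (2 ^ k) (2 ^ k) n) ⟩
  fun (odometer ^ₚ (2 ^ k + 2 ^ k)) n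
    ≡⟨ cong (λ s → fun (odometer ^ₚ s) n) 2^k+2^k≡2^[1+k]*1 ⟩
  fun (odometer ^ₚ (2 ^ suc k * 1)) n
    ≡⟨ odometer^-period (suc k) 1 le ⟩
  n ∎
  where
  2^k+2^k≡2^[1+k]*1 : 2 ^ k + 2 ^ k ≡ 2 ^ suc k * 1
  2^k+2^k≡2^[1+k]*1 = sym (trans (*-identityʳ _) (2^[1+n]≡2^n+2^n k))

odometer^-from-least : ∀ {L n} → level n ≡ suc L →
                       ∃[ j ] fun (odometer ^ₚ j) (least (suc L)) ≡ n
odometer^-from-least {L} {n} level≡ = j , word-injective _ n (begin
  word (fun (odometer ^ₚ j) (least (suc L))) ≡⟨ word-odometer^ j _ ⟩
  (rotate ^ᶠ j) (word (least (suc L)))       ≡⟨ cong (rotate ^ᶠ j) (word-index (s≤s z≤n)) ⟩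
  (rotate ^ᶠ j) (ones (suc L))               ≡⟨ cong ((rotate ^ᶠ j) ∘ ones) (sym level≡) ⟩
  (rotate ^ᶠ j) (ones (level n))             ≡⟨ reach ⟩
  word n                                     ∎)
  where
  j = proj₁ (rotate^-from-ones (word n))
  reach = proj₂ (rotate^-from-ones (word n))

child : ℕ → ℕ
child n = index 1+[2 word n ]

word-child : ∀ n → word (child n) ≡ 1+[2 word n ]
word-child n = word-index (s≤s z≤n)

level-child : ∀ n → level (child n) ≡ suc (level n)
level-child n = cong size (word-child n)

odometer^-fixes-child : ∀ t n → fun (odometer ^ₚ (t + t)) (child n) ≡ child n →
                        fun (odometer ^ₚ t) n ≡ n
odometer^-fixes-child t n fixed = from (odometer^-fixes⇔ t n) (1+[2_]-injective (begin
  1+[2 (rotate ^ᶠ t) (word n) ]        ≡⟨ sym (rotate^-double-1+[2_] t (word n)) ⟩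
  (rotate ^ᶠ (t + t)) 1+[2 word n ]    ≡⟨ cong (rotate ^ᶠ (t + t)) (sym (word-child n)) ⟩
  (rotate ^ᶠ (t + t)) (word (child n)) ≡⟨ to (odometer^-fixes⇔ (t + t) (child n)) fixed ⟩
  word (child n)                       ≡⟨ word-child n ⟩
  1+[2 word n ]                        ∎))

_≈[≤_]_ : Perm → ℕ → Perm → Set
p ≈[≤ N ] q = ∀ n → level n ≤ N → fun p n ≡ fun q n

Odometers : Perm → Set
Odometers p = ∀ N → ∃[ t ] p ≈[≤ N ] (odometer ^ₚ t)

odometer^∈Odometers : ∀ t → Odometers (odometer ^ₚ t)
odometer^∈Odometers t N = t , λ _ _ → refl

Odometers-preserve-level : ∀ {p} → Odometers p → ∀ n → level (fun p n) ≡ level n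
Odometers-preserve-level p∈ n =
  let (t , p≈) = p∈ (level n) in trans (cong level (p≈ n ≤-refl)) (level-odometer^ t n)

Odometers-isSubgroup : IsSubgroup Odometers
Odometers-isSubgroup = record
  { respects = λ p≈q p∈ N → let (t , p≈) = p∈ N in
                 t , λ n le → trans (sym (p≈q n)) (p≈ n le)
  ; has-id   = odometer^∈Odometers 0
  ; has-∘    = λ {p} {q} → ∘-closed {p} {q}
  ; has-⁻¹   = λ {p} → ⁻¹-closed {p}
  }
  where
  ∘-closed : ∀ {p q} → Odometers p → Odometers q → Odometers (p ∘ₚ q)
  ∘-closed {p} {q} p∈ q∈ N = a + b , λ n le → begin
    fun p (fun q n)                                 ≡⟨ cong (fun p) (q≈ n le) ⟩
    fun p (fun (odometer ^ₚ b) n)                   ≡⟨ p≈ _ (odometer^-level≤ b le) ⟩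
    fun (odometer ^ₚ a) (fun (odometer ^ₚ b) n)     ≡⟨ sym (^ₚ-+ odometer a b n) ⟩
    fun (odometer ^ₚ (a + b)) n                     ∎
    where
    a = proj₁ (p∈ N); p≈ = proj₂ (p∈ N)
    b = proj₁ (q∈ N); q≈ = proj₂ (q∈ N)

  -- odometer^(Q t) inverts odometer^t on the levels ≤ N, where 1 + Q = 2^N is a period.
  ⁻¹-closed : ∀ {p} → Odometers p → Odometers (p ⁻¹ₚ)
  ⁻¹-closed {p} p∈ N = Q * t , λ n le → begin
    inv p n                                       ≡⟨ cong (inv p) (sym (cancel n le)) ⟩
    inv p (fun p (fun (odometer ^ₚ (Q * t)) n))   ≡⟨ inv-l p _ ⟩
    fun (odometer ^ₚ (Q * t)) n                   ∎
    where
    t = proj₁ (p∈ N); p≈ = proj₂ (p∈ N)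
    Q = pred (2 ^ N)
    1+Q≡2^N : suc Q ≡ 2 ^ N
    1+Q≡2^N = suc-pred (2 ^ N) {{m^n≢0 2 N}}
    cancel : ∀ n → level n ≤ N → fun p (fun (odometer ^ₚ (Q * t)) n) ≡ n
    cancel n le = begin
      fun p (fun (odometer ^ₚ (Q * t)) n)
        ≡⟨ p≈ _ (odometer^-level≤ (Q * t) le) ⟩
      fun (odometer ^ₚ t) (fun (odometer ^ₚ (Q * t)) n)
        ≡⟨ sym (^ₚ-+ odometer t (Q * t) n) ⟩
      fun (odometer ^ₚ (suc Q * t)) n
        ≡⟨ cong (λ s → fun (odometer ^ₚ (s * t)) n) 1+Q≡2^N ⟩
      fun (odometer ^ₚ (2 ^ N * t)) n
        ≡⟨ odometer^-period N t le ⟩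
      n ∎

Odometers-closed : IsClosed Odometers
Odometers-closed p approx N =
  let (g , g∈ , g≈p) = approx (least (suc N)); (t , g≈) = g∈ N
  in t , λ n le → trans (sym (g≈p n (from <least⇔level≤ le))) (g≈ n le)

Odometers-finiteOrbits : HasFiniteOrbits Odometers
Odometers-finiteOrbits n = least (suc (level n)) , λ where
  _ (g , g∈ , refl) → from <least⇔level≤ (≤-reflexive (Odometers-preserve-level {g} g∈ n))

Odometers-isProfinite : IsProfinite Odometers
Odometers-isProfinite = record
  { isSubgroup   = Odometers-isSubgroup
  ; isClosed     = Odometers-closed
  ; finiteOrbits = Odometers-finiteOrbits
  }

InOrb-least⇔ : ∀ L {n} → InOrb Odometers (least (suc L)) n ⇔ level n ≡ suc L
InOrb-least⇔ L = mk⇔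
  (λ { (g , g∈ , refl) → trans (Odometers-preserve-level {g} g∈ _) (level-least L) })
  (λ level≡ → let (j , reach) = odometer^-from-least level≡ in
               odometer ^ₚ j , odometer^∈Odometers j , reach)

mutual
  Pre⇔level≤ : ∀ k {n} → Pre Odometers k n ⇔ level n ≤ suc k
  -- least 1 computes to 0, the representative that Rep prescribes for O_{G,0}.
  Pre⇔level≤ zero {n} = mk⇔
    (λ { (_ , refl , o) → ≤-reflexive (to (InOrb-least⇔ 0) o) })
    (λ le → 0 , refl , from (InOrb-least⇔ 0) (≤-antisym le (0<level n)))
  Pre⇔level≤ (suc k) {n} = mk⇔ pre⇒ ⇒pre
    where
    pre⇒ : Pre Odometers (suc k) n → level n ≤ suc (suc k)
    pre⇒ (inj₁ pre)            = m≤n⇒m≤1+n (to (Pre⇔level≤ k) pre)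
    pre⇒ (inj₂ (_ , rep , o)) with to (Rep⇔least k) rep
    ... | refl = ≤-reflexive (to (InOrb-least⇔ (suc k)) o)
    ⇒pre : level n ≤ suc (suc k) → Pre Odometers (suc k) n
    ⇒pre le with level n ≤? suc k
    ... | yes le′ = inj₁ (from (Pre⇔level≤ k) le′)
    ... | no  gt  =
      inj₂ (_ , from (Rep⇔least k) refl , from (InOrb-least⇔ (suc k)) (≤-antisym le (≰⇒> gt)))

  Rep⇔least : ∀ k {r} → Rep Odometers (suc k) r ⇔ r ≡ least (suc (suc k))
  Rep⇔least k = mk⇔
    (λ (¬pre , lower) → ≤-antisym (≮⇒≥ (λ b<r → <-irrefl refl (to below (lower _ b<r))))
                                  (≮⇒≥ (¬pre ∘ from below)))
    (λ { refl → (λ pre → <-irrefl refl (to below pre)) , (λ _ → from below) })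
    where
    below : ∀ {m} → Pre Odometers k m ⇔ m < least (suc (suc k))
    below = ⇔-sym <least⇔level≤ ⇔-∘ Pre⇔level≤ k

Odometers-torsionFree : ∀ {x} → Odometers x → (x ∘ₚ x) ≈ₚ idₚ → x ≈ₚ idₚ
Odometers-torsionFree {x} x∈ x²≈id n =
  trans (x≈ n (n≤1+n _)) (odometer^-fixes-child t n child-fixed)
  where
  t = proj₁ (x∈ (suc (level n))); x≈ = proj₂ (x∈ (suc (level n)))
  c = child n
  c≤ : level c ≤ suc (level n)
  c≤ = ≤-reflexive (level-child n)
  child-fixed : fun (odometer ^ₚ (t + t)) c ≡ c
  child-fixed = begin
    fun (odometer ^ₚ (t + t)) c                   ≡⟨ ^ₚ-+ odometer t t c ⟩
    fun (odometer ^ₚ t) (fun (odometer ^ₚ t) c)   ≡⟨ sym (x≈ _ (odometer^-level≤ t c≤)) ⟩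
    fun x (fun (odometer ^ₚ t) c)                 ≡⟨ cong (fun x) (sym (x≈ c c≤)) ⟩
    fun x (fun x c)                               ≡⟨ x²≈id c ⟩
    c                                             ∎

hasInvolution : ExSentence
hasInvolution = ∃ˢ 1 ((¬ᶠ (x ≐ e)) ∧ᶠ ((x · x) ≐ e))
  where x = var x₀

Gₖ⊨hasInvolution : ∀ k → groupGk Odometers Odometers-isSubgroup k ⊨ hasInvolution
Gₖ⊨hasInvolution k = (λ _ → σ , odometer^∈Odometers (2 ^ k)) , moves , squares
  where
  σ = odometer ^ₚ (2 ^ k)
  moves : ¬ (∀ n → Pre Odometers k n → fun σ n ≡ n)
  moves fixes =
    odometer^-moves-least k (fixes _ (from (Pre⇔level≤ k) (≤-reflexive (level-least k))))
  squares : ∀ n → Pre Odometers k n → fun σ (fun σ n) ≡ n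
  squares n = odometer^[2^k]-involutive k ∘ to (Pre⇔level≤ k)

G⊭hasInvolution : ¬ (groupG Odometers Odometers-isSubgroup ⊨ hasInvolution)
G⊭hasInvolution (ρ , x≉id , x²≈id) =
  x≉id (Odometers-torsionFree {proj₁ (ρ x₀)} (proj₂ (ρ x₀)) x²≈id)

proposition8 : Σ[ G ∈ (Perm → Set) ] Σ[ hG ∈ IsProfinite G ] Σ[ α ∈ ExSentence ]
                 ((∀ (k : ℕ) → groupGk G (isSubgroup hG) k ⊨ α)
                  × ¬ (groupG G (isSubgroup hG) ⊨ α))
proposition8 =
  Odometers , Odometers-isProfinite , hasInvolution , Gₖ⊨hasInvolution , G⊭hasInvolution
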